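{- If $F$ and $K$ are finite fields, then $$\gamma^o(\Gamma(F\times K)) = \min\{|F| -1, |K|-1 \}.$$
   Context: For a finite commutative ring $R$ with identity, $Z(R)^*$ denotes the set of nonzero zero-divisors of $R$. The zero-divisor graph $\Gamma(R)$ is the simple graph with vertex set $Z(R)^*$, in which distinct $u,v$ are adjacent if and only if $uv=0$. For a simple graph $\Gamma=(V,E)$, a set $S\subseteq V$ and a vertex $v$, let $\delta_S(v)$ be the number of neighbors of $v$ in $S$ and $\overline{S}=V\setminus S$. A nonempty set $S\subseteq V$ is a global offensive alliance if $\delta_S(v)\geq \delta_{\overline{S}}(v)+1$ for every $v\in\overline{S}$. $\gamma^o(\Gamma)$ is the minimum cardinality of a global offensive alliance of $\Gamma$. -}

module Defs where

open import Level using (Level; _⊔_) renaming (suc to lsuc)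
open import Algebra.Bundles using (CommutativeRing)
import Algebra.Construct.DirectProduct as DP
open import Data.Nat using (ℕ; _≤_) renaming (_*_ to _*ℕ_; _+_ to _+ℕ_)
open import Data.Fin using (Fin; combine; remQuot)
open import Data.Fin.Properties using (any?; combine-remQuot; remQuot-combine)
import Data.Fin.Properties as FinP
open import Data.Fin.Subset using (Subset; _∈_; _∉_; _⊆_; _∩_; ∁; ∣_∣; Nonempty)
open import Data.Vec using (tabulate)
open import Data.Product using (Σ; ∃; ∃-syntax; _×_; _,_; proj₁; proj₂)
open import Relation.Nullary using (¬_; Dec; yes; no; does)
open import Relation.Nullary.Decidable using (_×-dec_; ¬?; map′)
open import Relation.Binary.PropositionalEquality as ≡ using (_≡_; _≢_)
open import Function.Bundles using (Inverse)

-- Finite commutative rings: a commutative ring (with setoid equality ≈)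
-- together with a bijection (up to ≈) between its carrier and Fin size.
-- So |R| = size.

record FiniteCommRing (c ℓ : Level) : Set (lsuc (c ⊔ ℓ)) where
  field
    cring : CommutativeRing c ℓ
    size : ℕ
    enum : Inverse (CommutativeRing.setoid cring) (≡.setoid (Fin size))

  open CommutativeRing cring public hiding (ring)

  elt : Fin size → Carrier
  elt = Inverse.from enum

  private
    module E = Inverse enum

  _≈?_ : (x y : Carrier) → Dec (x ≈ y)
  x ≈? y = map′ to⇒ E.to-cong (E.to x FinP.≟ E.to y)
    where
    to⇒ : E.to x ≡ E.to y → x ≈ y
    to⇒ eq = trans (sym (E.inverseʳ ≡.refl))
                   (trans (E.from-cong eq) (E.inverseʳ ≡.refl))

  IsZeroDivisor : Carrier → Set (c ⊔ ℓ)
  IsZeroDivisor x = ∃[ y ] (¬ (y ≈ 0#) × x * y ≈ 0#)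

  isZeroDivisor? : (x : Carrier) → Dec (IsZeroDivisor x)
  isZeroDivisor? x =
    map′ (λ { (j , p , q) → elt j , p , q })
         (λ { (y , p , q) → E.to y
                , (λ e → p (trans (sym (E.inverseʳ ≡.refl)) e))
                , trans (*-congˡ (E.inverseʳ ≡.refl)) q })
         (any? (λ j → ¬? (elt j ≈? 0#) ×-dec ((x * elt j) ≈? 0#)))

  IsVertex : Fin size → Set (c ⊔ ℓ)
  IsVertex i = ¬ (elt i ≈ 0#) × IsZeroDivisor (elt i)

  isVertex? : (i : Fin size) → Dec (IsVertex i)
  isVertex? i = ¬? (elt i ≈? 0#) ×-dec isZeroDivisor? (elt i)

  Adj : Fin size → Fin size → Set (c ⊔ ℓ)
  Adj i j = IsVertex i × IsVertex j × i ≢ j × (elt i * elt j ≈ 0#)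

  adj? : (i j : Fin size) → Dec (Adj i j)
  adj? i j = isVertex? i ×-dec isVertex? j ×-dec ¬? (i FinP.≟ j)
               ×-dec ((elt i * elt j) ≈? 0#)

  V : Subset size
  V = tabulate (λ i → does (isVertex? i))

  N : Fin size → Subset size
  N v = tabulate (λ j → does (adj? v j))

  δ : Subset size → Fin size → ℕ
  δ S v = ∣ S ∩ N v ∣

  compl : Subset size → Subset size
  compl S = V ∩ ∁ S

  IsGlobalOffensiveAlliance : Subset size → Set
  IsGlobalOffensiveAlliance S =
    Nonempty S × S ⊆ V ×
    (∀ v → v ∈ compl S → δ (compl S) v +ℕ 1 ≤ δ S v)

  -- γᵒ(Γ(R)) = k : k is the minimum cardinality of a global offensive alliance
  OffensiveAllianceNumber≡ : ℕ → Set
  OffensiveAllianceNumber≡ k =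
    (∃[ S ] (IsGlobalOffensiveAlliance S × ∣ S ∣ ≡ k)) ×
    (∀ S → IsGlobalOffensiveAlliance S → k ≤ ∣ S ∣)

IsField : ∀ {c ℓ} → CommutativeRing c ℓ → Set (c ⊔ ℓ)
IsField R = ¬ (1# ≈ 0#) × (∀ x → ¬ (x ≈ 0#) → ∃[ y ] (x * y ≈ 1#))
  where open CommutativeRing R

record FiniteField (c ℓ : Level) : Set (lsuc (c ⊔ ℓ)) where
  field
    finRing : FiniteCommRing c ℓ
    isField : IsField (FiniteCommRing.cring finRing)
  open FiniteCommRing finRing public

_×FR_ : ∀ {c₁ ℓ₁ c₂ ℓ₂} → FiniteCommRing c₁ ℓ₁ → FiniteCommRing c₂ ℓ₂ →
        FiniteCommRing (c₁ ⊔ c₂) (ℓ₁ ⊔ ℓ₂)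
_×FR_ R S = record
  { cring = PR
  ; size = R.size *ℕ S.size
  ; enum = record
    { to = to
    ; from = from
    ; to-cong = λ { (p , q) → ≡.cong₂ combine (A.to-cong p) (B.to-cong q) }
    ; from-cong = λ { ≡.refl → R.refl , S.refl }
    ; inverse = invˡ , invʳ
    }
  }
  where
  module R = FiniteCommRing R
  module S = FiniteCommRing S
  module A = Inverse R.enum
  module B = Inverse S.enum
  PR = DP.commutativeRing R.cring S.cring
  module P = CommutativeRing PR
  to : R.Carrier × S.Carrier → Fin (R.size *ℕ S.size)
  to (x , y) = combine (A.to x) (B.to y)
  from : Fin (R.size *ℕ S.size) → R.Carrier × S.Carrier
  from i = A.from (proj₁ (remQuot {R.size} S.size i)) , B.from (proj₂ (remQuot {R.size} S.size i))
  invˡ : ∀ {i y} → y P.≈ from i → to y ≡ i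
  invˡ {i} {(y₁ , y₂)} (p , q) =
    ≡.trans (≡.cong₂ combine (A.inverseˡ p) (B.inverseˡ q)) (combine-remQuot {R.size} S.size i)
  invʳ : ∀ {x i} → i ≡ to x → from i P.≈ x
  invʳ {(x₁ , x₂)} ≡.refl =
    A.inverseʳ (≡.cong proj₁ e) , B.inverseʳ (≡.cong proj₂ e)
    where e = remQuot-combine {R.size} {S.size} (A.to x₁) (B.to x₂)

-- Γ(F × K) is the complete bipartite graph with parts F* × 0 and 0 × K*. In a complete
-- bipartite graph with nonempty parts A and B, a whole part is an offensive alliance: a vertex
-- outside it lies in the other part, so all its neighbours are in the alliance. Conversely, if
-- an alliance S misses a vertex of A, that vertex forces |B ∖ S| < |S ∩ B|; if it also misses a
-- vertex of B then |A ∖ S| < |S ∩ A|, and together these give min(|A|, |B|) ≤ |S ∩ A| + |S ∩ B|.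
-- Otherwise S contains A or B.

module Submission where

open import Defs
open import Data.Bool using (Bool; true; false; not; _∧_)
open import Data.Nat using (ℕ; zero; suc; _+_; _∸_; _⊓_; _≤_; _<_) renaming (_*_ to _*ℕ_)
open import Data.Nat.Properties
  using (*-identityˡ; *-identityʳ; ≤-trans; ≤-total; +-comm; +-monoʳ-≤; <⇒≤; m⊓n≤m; m⊓n≤n;
         m≤n⇒m⊓n≡m; m≥n⇒m⊓n≡n; module ≤-Reasoning)
open import Data.Fin using (Fin; zero; suc; combine; remQuot)
open import Data.Fin.Properties using (combine-remQuot)
open import Data.Fin.Subset
  using (Subset; _∈_; _∉_; _⊆_; _∩_; ∁; ⊥; ⁅_⁆; ∣_∣; Nonempty; Empty)
open import Data.Fin.Subset.Properties
  using (⊆-antisym; p⊆q⇒∣p∣≤∣q∣; x∈⁅x⁆; x∈⁅y⁆⇒x≡y; ∣⁅x⁆∣≡1; ∣⊥∣≡0; ∣∁p∣≡n∸∣p∣;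
         x∈p∩q⁺; x∈p∩q⁻; x∈∁p⇒x∉p; x∉p⇒x∈∁p; x∉∁p⇒x∈p; nonempty?;
         ∩-assoc; ∩-comm; ∩-idem; ∩-inverseˡ; ∩-zeroʳ)
open import Data.Vec using ([]; _∷_; tabulate; lookup; _++_; concat)
open import Data.Vec.Properties
  using (lookup∘tabulate; tabulate∘lookup; tabulate-cong; tabulate-∘; lookup-concat;
         []=⇒lookup; lookup⇒[]=)
open import Data.Product using (∃-syntax; _×_; _,_; proj₁; proj₂)
open import Data.Sum using (_⊎_; inj₁; inj₂)
import Data.Sum as Sum
open import Relation.Nullary using (¬_; Dec; yes; no; does; contradiction)
open import Relation.Nullary.Decidable using (_×-dec_; ¬?; dec-true)
open import Relation.Binary.PropositionalEquality
  using (_≡_; refl; sym; trans; cong; cong₂; subst; module ≡-Reasoning)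
open import Function.Bundles using (Inverse)

private
  variable
    n m : ℕ

x<a∧y<b⇒[a+x]⊓[b+y]≤a+b : ∀ {a b x y} → x < a → y < b → (a + x) ⊓ (b + y) ≤ a + b
x<a∧y<b⇒[a+x]⊓[b+y]≤a+b {a} {b} {x} {y} x<a y<b with ≤-total a b
... | inj₁ a≤b = ≤-trans (m⊓n≤m (a + x) (b + y)) (+-monoʳ-≤ a (≤-trans (<⇒≤ x<a) a≤b))
... | inj₂ b≤a = ≤-trans (m⊓n≤n (a + x) (b + y))
                   (subst (b + y ≤_) (+-comm b a) (+-monoʳ-≤ b (≤-trans (<⇒≤ y<b) b≤a)))

module _ {a} {P : Fin n → Set a} (P? : ∀ i → Dec (P i)) where

  ∈-tabulate-does⁺ : ∀ {i} → P i → i ∈ tabulate (λ j → does (P? j))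
  ∈-tabulate-does⁺ {i} p = lookup⇒[]= i _ (trans (lookup∘tabulate _ i) (dec-true (P? i) p))

  ∈-tabulate-does⁻ : ∀ {i} → i ∈ tabulate (λ j → does (P? j)) → P i
  ∈-tabulate-does⁻ {i} i∈ = from-true (P? i) (trans (sym (lookup∘tabulate _ i)) ([]=⇒lookup i∈))
    where
    from-true : ∀ {A : Set a} (d : Dec A) → does d ≡ true → A
    from-true (yes x) _ = x

Nonempty⇒1≤∣p∣ : {p : Subset n} → Nonempty p → 1 ≤ ∣ p ∣
Nonempty⇒1≤∣p∣ {p = p} (x , x∈p) =
  subst (_≤ ∣ p ∣) (∣⁅x⁆∣≡1 x) (p⊆q⇒∣p∣≤∣q∣ λ y∈⁅x⁆ → subst (_∈ p) (sym (x∈⁅y⁆⇒x≡y x y∈⁅x⁆)) x∈p)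

Empty[p∩∁q]⇒p⊆q : {p q : Subset n} → Empty (p ∩ ∁ q) → p ⊆ q
Empty[p∩∁q]⇒p⊆q empty x∈p = x∉∁p⇒x∈p λ x∈∁q → empty (_ , x∈p∩q⁺ (x∈p , x∈∁q))

∣p∩q∣+∣p∩∁q∣≡∣p∣ : (p q : Subset n) → ∣ p ∩ q ∣ + ∣ p ∩ ∁ q ∣ ≡ ∣ p ∣
∣p∩q∣+∣p∩∁q∣≡∣p∣ []          []          = refl
∣p∩q∣+∣p∩∁q∣≡∣p∣ (true ∷ p)  (true ∷ q)  = cong suc (∣p∩q∣+∣p∩∁q∣≡∣p∣ p q)
∣p∩q∣+∣p∩∁q∣≡∣p∣ (true ∷ p)  (false ∷ q) =
  trans (+-comm ∣ p ∩ q ∣ _) (cong suc (trans (+-comm _ ∣ p ∩ q ∣) (∣p∩q∣+∣p∩∁q∣≡∣p∣ p q)))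
∣p∩q∣+∣p∩∁q∣≡∣p∣ (false ∷ p) (true ∷ q)  = ∣p∩q∣+∣p∩∁q∣≡∣p∣ p q
∣p∩q∣+∣p∩∁q∣≡∣p∣ (false ∷ p) (false ∷ q) = ∣p∩q∣+∣p∩∁q∣≡∣p∣ p q

∣p∩q∣+∣p∩r∣≤∣p∣ : (p q r : Subset n) → (∀ {i} → i ∈ q → i ∉ r) → ∣ p ∩ q ∣ + ∣ p ∩ r ∣ ≤ ∣ p ∣
∣p∩q∣+∣p∩r∣≤∣p∣ p q r disjoint = begin
  ∣ p ∩ q ∣ + ∣ p ∩ r ∣   ≤⟨ +-monoʳ-≤ ∣ p ∩ q ∣ (p⊆q⇒∣p∣≤∣q∣ p∩r⊆p∩∁q) ⟩
  ∣ p ∩ q ∣ + ∣ p ∩ ∁ q ∣ ≡⟨ ∣p∩q∣+∣p∩∁q∣≡∣p∣ p q ⟩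
  ∣ p ∣                   ∎
  where
  open ≤-Reasoning
  p∩r⊆p∩∁q : p ∩ r ⊆ p ∩ ∁ q
  p∩r⊆p∩∁q i∈ = let i∈p , i∈r = x∈p∩q⁻ p r i∈ in
                x∈p∩q⁺ (i∈p , x∉p⇒x∈∁p λ i∈q → disjoint i∈q i∈r)

∣[r∩∁p]∩p∣≡0 : (r p : Subset n) → ∣ (r ∩ ∁ p) ∩ p ∣ ≡ 0
∣[r∩∁p]∩p∣≡0 {n} r p = begin
  ∣ (r ∩ ∁ p) ∩ p ∣ ≡⟨ cong ∣_∣ (∩-assoc r (∁ p) p) ⟩
  ∣ r ∩ (∁ p ∩ p) ∣ ≡⟨ cong (λ s → ∣ r ∩ s ∣) (∩-inverseˡ p) ⟩
  ∣ r ∩ ⊥ ∣         ≡⟨ cong ∣_∣ (∩-zeroʳ r) ⟩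
  ∣ ⊥ {n} ∣         ≡⟨ ∣⊥∣≡0 n ⟩
  0                 ∎
  where open ≡-Reasoning

∣p++q∣≡∣p∣+∣q∣ : (p : Subset m) (q : Subset n) → ∣ p ++ q ∣ ≡ ∣ p ∣ + ∣ q ∣
∣p++q∣≡∣p∣+∣q∣ []          q = refl
∣p++q∣≡∣p∣+∣q∣ (true ∷ p)  q = cong suc (∣p++q∣≡∣p∣+∣q∣ p q)
∣p++q∣≡∣p∣+∣q∣ (false ∷ p) q = ∣p++q∣≡∣p∣+∣q∣ p q

∣tabulate-false∣≡0 : ∀ n → ∣ tabulate {n = n} (λ _ → false) ∣ ≡ 0
∣tabulate-false∣≡0 zero    = refl
∣tabulate-false∣≡0 (suc n) = ∣tabulate-false∣≡0 n

tabulate-remQuot : ∀ {a} {A : Set a} (g : Fin m → Fin n → A) →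
  tabulate (λ k → g (proj₁ (remQuot {m} n k)) (proj₂ (remQuot {m} n k))) ≡
  concat (tabulate λ i → tabulate (g i))
tabulate-remQuot {m} {n} g = begin
  tabulate (λ k → g (quot k) (rem k))                  ≡⟨ tabulate-cong entry ⟩
  tabulate (lookup (concat xss))                      ≡⟨ tabulate∘lookup (concat xss) ⟩
  concat xss                                          ∎
  where
  open ≡-Reasoning
  quot = λ k → proj₁ (remQuot {m} n k)
  rem  = λ k → proj₂ (remQuot {m} n k)
  xss  = tabulate λ i → tabulate (g i)
  entry : ∀ k → g (quot k) (rem k) ≡ lookup (concat xss) k
  entry k = begin
    g (quot k) (rem k)                          ≡⟨ lookup∘tabulate (g (quot k)) (rem k) ⟨
    lookup (tabulate (g (quot k))) (rem k)      ≡⟨ cong (λ xs → lookup xs (rem k)) (lookup∘tabulate _ (quot k)) ⟨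
    lookup (lookup xss (quot k)) (rem k)        ≡⟨ lookup-concat xss (quot k) (rem k) ⟨
    lookup (concat xss) (combine (quot k) (rem k)) ≡⟨ cong (lookup (concat xss)) (combine-remQuot {m} n k) ⟩
    lookup (concat xss) k                       ∎

∣concat-∧∣ : (f : Fin m → Bool) (g : Fin n → Bool) →
  ∣ concat (tabulate λ i → tabulate λ j → f i ∧ g j) ∣ ≡ ∣ tabulate f ∣ *ℕ ∣ tabulate g ∣
∣concat-∧∣ {zero}  f g = refl
∣concat-∧∣ {suc m} {n} f g
  rewrite ∣p++q∣≡∣p∣+∣q∣ (tabulate λ j → f zero ∧ g j) (concat (tabulate λ i → tabulate λ j → f (suc i) ∧ g j))
        | ∣concat-∧∣ (λ i → f (suc i)) g
  with f zero
... | true  = refl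
... | false = cong (_+ ∣ tabulate (λ i → f (suc i)) ∣ *ℕ ∣ tabulate g ∣) (∣tabulate-false∣≡0 n)

∣tabulate-∧-remQuot∣ : (f : Fin m → Bool) (g : Fin n → Bool) →
  ∣ tabulate (λ k → f (proj₁ (remQuot {m} n k)) ∧ g (proj₂ (remQuot {m} n k))) ∣ ≡
  ∣ tabulate f ∣ *ℕ ∣ tabulate g ∣
∣tabulate-∧-remQuot∣ f g = trans (cong ∣_∣ (tabulate-remQuot λ i j → f i ∧ g j)) (∣concat-∧∣ f g)

module Zeros {c ℓ} (R : FiniteCommRing c ℓ) where

  open FiniteCommRing R using (size; elt; enum; _≈?_; 0#)
  private
    module R = FiniteCommRing R
    module E = Inverse enum

  zeros : Subset size
  zeros = tabulate (λ i → does (elt i ≈? 0#))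

  ∣zeros∣≡1 : ∣ zeros ∣ ≡ 1
  ∣zeros∣≡1 = trans (cong ∣_∣ zeros≡⁅0⁆) (∣⁅x⁆∣≡1 (E.to 0#))
    where
    zeros≡⁅0⁆ : zeros ≡ ⁅ E.to 0# ⁆
    zeros≡⁅0⁆ = ⊆-antisym
      (λ {i} i∈ → subst (_∈ ⁅ E.to 0# ⁆)
                   (trans (sym (E.to-cong (∈-tabulate-does⁻ (λ j → elt j ≈? 0#) i∈))) (E.inverseˡ R.refl))
                   (x∈⁅x⁆ (E.to 0#)))
      (λ {i} i∈ → ∈-tabulate-does⁺ (λ j → elt j ≈? 0#) (E.inverseʳ (x∈⁅y⁆⇒x≡y (E.to 0#) i∈)))

  nonzeros : Subset size
  nonzeros = tabulate (λ i → does (¬? (elt i ≈? 0#)))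

  ∣nonzeros∣≡size∸1 : ∣ nonzeros ∣ ≡ size ∸ 1
  ∣nonzeros∣≡size∸1 = begin
    ∣ nonzeros ∣                                  ≡⟨ cong ∣_∣ (tabulate-∘ not (λ i → does (elt i ≈? 0#))) ⟩
    ∣ ∁ zeros ∣                                   ≡⟨ ∣∁p∣≡n∸∣p∣ zeros ⟩
    size ∸ ∣ zeros ∣                              ≡⟨ cong (size ∸_) ∣zeros∣≡1 ⟩
    size ∸ 1                                      ∎
    where open ≡-Reasoning

module ZeroDivisorGraph {c ℓ} (R : FiniteCommRing c ℓ) where

  open FiniteCommRing R
    using (size; IsVertex; isVertex?; Adj; adj?; V; N; δ; compl;
           IsGlobalOffensiveAlliance; OffensiveAllianceNumber≡)
  private
    module R = FiniteCommRing R

  ∈V⁺ : ∀ {i} → IsVertex i → i ∈ V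
  ∈V⁺ = ∈-tabulate-does⁺ isVertex?

  ∈V⁻ : ∀ {i} → i ∈ V → IsVertex i
  ∈V⁻ = ∈-tabulate-does⁻ isVertex?

  ∈N⁺ : ∀ {v j} → Adj v j → j ∈ N v
  ∈N⁺ {v} = ∈-tabulate-does⁺ (adj? v)

  ∈N⁻ : ∀ {v j} → j ∈ N v → Adj v j
  ∈N⁻ {v} = ∈-tabulate-does⁻ (adj? v)

  Adj-sym : ∀ {i j} → Adj i j → Adj j i
  Adj-sym (i-vertex , j-vertex , i≢j , ij≈0) =
    j-vertex , i-vertex , (λ j≡i → i≢j (sym j≡i)) , R.trans (R.*-comm _ _) ij≈0

  v∉N[v] : ∀ {v} → v ∉ N v
  v∉N[v] v∈Nv = let (_ , _ , v≢v , _) = ∈N⁻ v∈Nv in v≢v refl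

  N≡ : ∀ {v} {X : Subset size} → (∀ {j} → Adj v j → j ∈ X) → (∀ {j} → j ∈ X → Adj v j) → N v ≡ X
  N≡ adj⇒∈ ∈⇒adj = ⊆-antisym (λ j∈N → adj⇒∈ (∈N⁻ j∈N)) (λ j∈X → ∈N⁺ (∈⇒adj j∈X))

  record IsCompleteBipartite (A B : Subset size) : Set where
    field
      A⊆V : A ⊆ V
      B⊆V : B ⊆ V
      V⊆A∪B : ∀ {i} → i ∈ V → i ∈ A ⊎ i ∈ B
      N[A]≡B : ∀ {v} → v ∈ A → N v ≡ B
      N[B]≡A : ∀ {v} → v ∈ B → N v ≡ A

    disjoint : ∀ {i} → i ∈ A → i ∉ B
    disjoint i∈A i∈B = v∉N[v] (subst (_ ∈_) (sym (N[A]≡B i∈A)) i∈B)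

    swap : IsCompleteBipartite B A
    swap = record
      { A⊆V = B⊆V ; B⊆V = A⊆V ; V⊆A∪B = λ i∈V → Sum.swap (V⊆A∪B i∈V)
      ; N[A]≡B = N[B]≡A ; N[B]≡A = N[A]≡B }

  module _ {A B : Subset size} (bip : IsCompleteBipartite A B) where

    open IsCompleteBipartite bip

    part-isGlobalOffensiveAlliance : Nonempty A → IsGlobalOffensiveAlliance A
    part-isGlobalOffensiveAlliance A≢∅ = A≢∅ , A⊆V , offensive
      where
      offensive : ∀ v → v ∈ compl A → δ (compl A) v + 1 ≤ δ A v
      offensive v v∈ with x∈p∩q⁻ V (∁ A) v∈
      ... | v∈V , v∈∁A with V⊆A∪B v∈V
      ... | inj₁ v∈A = contradiction v∈A (x∈∁p⇒x∉p v∈∁A)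
      ... | inj₂ v∈B rewrite N[B]≡A v∈B | ∣[r∩∁p]∩p∣≡0 V A | ∩-idem A = Nonempty⇒1≤∣p∣ A≢∅

    ∣B∩∁S∣<∣S∩B∣ : ∀ {S v} → IsGlobalOffensiveAlliance S → v ∈ A → v ∉ S → ∣ B ∩ ∁ S ∣ < ∣ S ∩ B ∣
    ∣B∩∁S∣<∣S∩B∣ {S} {v} (_ , _ , offensive) v∈A v∉S = begin-strict
      ∣ B ∩ ∁ S ∣          ≤⟨ p⊆q⇒∣p∣≤∣q∣ B∖S⊆complS∩B ⟩
      ∣ compl S ∩ B ∣      <⟨ subst (_≤ ∣ S ∩ B ∣) (+-comm _ 1) at-v ⟩
      ∣ S ∩ B ∣            ∎
      where
      open ≤-Reasoning
      at-v : ∣ compl S ∩ B ∣ + 1 ≤ ∣ S ∩ B ∣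
      at-v = subst (λ X → ∣ compl S ∩ X ∣ + 1 ≤ ∣ S ∩ X ∣) (N[A]≡B v∈A)
                   (offensive v (x∈p∩q⁺ (A⊆V v∈A , x∉p⇒x∈∁p v∉S)))
      B∖S⊆complS∩B : B ∩ ∁ S ⊆ compl S ∩ B
      B∖S⊆complS∩B i∈ = let i∈B , i∈∁S = x∈p∩q⁻ B (∁ S) i∈ in
                        x∈p∩q⁺ (x∈p∩q⁺ (B⊆V i∈B , i∈∁S) , i∈B)

  module _ {A B : Subset size} (bip : IsCompleteBipartite A B) where

    open IsCompleteBipartite bip

    ∣A∣⊓∣B∣≤∣S∣ : ∀ {S} → IsGlobalOffensiveAlliance S → ∣ A ∣ ⊓ ∣ B ∣ ≤ ∣ S ∣
    ∣A∣⊓∣B∣≤∣S∣ {S} alliance with nonempty? (A ∩ ∁ S) | nonempty? (B ∩ ∁ S)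
    ... | no A⊆S | _     = ≤-trans (m⊓n≤m ∣ A ∣ ∣ B ∣) (p⊆q⇒∣p∣≤∣q∣ (Empty[p∩∁q]⇒p⊆q A⊆S))
    ... | yes _  | no B⊆S = ≤-trans (m⊓n≤n ∣ A ∣ ∣ B ∣) (p⊆q⇒∣p∣≤∣q∣ (Empty[p∩∁q]⇒p⊆q B⊆S))
    ... | yes (v , v∈A∖S) | yes (w , w∈B∖S) = begin
      ∣ A ∣ ⊓ ∣ B ∣                                         ≡⟨ cong₂ _⊓_ (split A) (split B) ⟨
      (∣ S ∩ A ∣ + ∣ A ∩ ∁ S ∣) ⊓ (∣ S ∩ B ∣ + ∣ B ∩ ∁ S ∣) ≤⟨ x<a∧y<b⇒[a+x]⊓[b+y]≤a+b A∖S-small B∖S-small ⟩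
      ∣ S ∩ A ∣ + ∣ S ∩ B ∣                                 ≤⟨ ∣p∩q∣+∣p∩r∣≤∣p∣ S A B disjoint ⟩
      ∣ S ∣                                                 ∎
      where
      open ≤-Reasoning
      split : ∀ X → ∣ S ∩ X ∣ + ∣ X ∩ ∁ S ∣ ≡ ∣ X ∣
      split X = trans (cong (λ Y → ∣ Y ∣ + ∣ X ∩ ∁ S ∣) (∩-comm S X)) (∣p∩q∣+∣p∩∁q∣≡∣p∣ X S)
      outside : ∀ {X i} → i ∈ X ∩ ∁ S → i ∈ X × i ∉ S
      outside {X} i∈ = let i∈X , i∈∁S = x∈p∩q⁻ X (∁ S) i∈ in i∈X , x∈∁p⇒x∉p i∈∁S
      A∖S-small : ∣ A ∩ ∁ S ∣ < ∣ S ∩ A ∣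
      A∖S-small = let w∈B , w∉S = outside w∈B∖S in ∣B∩∁S∣<∣S∩B∣ swap alliance w∈B w∉S
      B∖S-small : ∣ B ∩ ∁ S ∣ < ∣ S ∩ B ∣
      B∖S-small = let v∈A , v∉S = outside v∈A∖S in ∣B∩∁S∣<∣S∩B∣ bip alliance v∈A v∉S

    offensiveAllianceNumber≡∣A∣⊓∣B∣ : Nonempty A → Nonempty B → OffensiveAllianceNumber≡ (∣ A ∣ ⊓ ∣ B ∣)
    offensiveAllianceNumber≡∣A∣⊓∣B∣ A≢∅ B≢∅ = smaller-side , λ S → ∣A∣⊓∣B∣≤∣S∣
      where
      smaller-side : ∃[ S ] (IsGlobalOffensiveAlliance S × ∣ S ∣ ≡ ∣ A ∣ ⊓ ∣ B ∣)
      smaller-side with ≤-total ∣ A ∣ ∣ B ∣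
      ... | inj₁ ∣A∣≤∣B∣ = A , part-isGlobalOffensiveAlliance bip A≢∅ , sym (m≤n⇒m⊓n≡m ∣A∣≤∣B∣)
      ... | inj₂ ∣B∣≤∣A∣ = B , part-isGlobalOffensiveAlliance swap B≢∅ , sym (m≥n⇒m⊓n≡n ∣B∣≤∣A∣)

module FieldProperties {c ℓ} (F : FiniteField c ℓ) where

  open FiniteField F using (_≈_; _*_; 0#; 1#; isField)
  private
    module F = FiniteField F
  open import Relation.Binary.Reasoning.Setoid F.setoid

  1≉0 : ¬ 1# ≈ 0#
  1≉0 = proj₁ isField

  x*y≈0⇒y≈0 : ∀ {x y} → ¬ x ≈ 0# → x * y ≈ 0# → y ≈ 0#
  x*y≈0⇒y≈0 {x} {y} x≉0 xy≈0 = let x⁻¹ , xx⁻¹≈1 = proj₂ isField x x≉0 in begin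
    y              ≈⟨ F.*-identityˡ y ⟨
    1# * y         ≈⟨ F.*-congʳ (F.trans (F.*-comm x⁻¹ x) xx⁻¹≈1) ⟨
    (x⁻¹ * x) * y  ≈⟨ F.*-assoc x⁻¹ x y ⟩
    x⁻¹ * (x * y)  ≈⟨ F.*-congˡ xy≈0 ⟩
    x⁻¹ * 0#       ≈⟨ F.zeroʳ x⁻¹ ⟩
    0#             ∎

  x*y≈0⇒x≈0 : ∀ {x y} → ¬ y ≈ 0# → x * y ≈ 0# → x ≈ 0#
  x*y≈0⇒x≈0 {x} {y} y≉0 xy≈0 = x*y≈0⇒y≈0 y≉0 (F.trans (F.*-comm y x) xy≈0)

module FieldProduct {c₁ ℓ₁ c₂ ℓ₂} (F : FiniteField c₁ ℓ₁) (K : FiniteField c₂ ℓ₂) where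

  private
    module F = FiniteField F
    module K = FiniteField K
    module F′ = FieldProperties F
    module K′ = FieldProperties K
    module E = Inverse (FiniteCommRing.enum (F.finRing ×FR K.finRing))

  open FiniteCommRing (F.finRing ×FR K.finRing) using (size; elt; IsVertex; Adj; N)
  open ZeroDivisorGraph (F.finRing ×FR K.finRing)

  OnAxis₁ OnAxis₂ : Fin size → Set _
  OnAxis₁ i = ¬ proj₁ (elt i) F.≈ F.0# × proj₂ (elt i) K.≈ K.0#
  OnAxis₂ i = proj₁ (elt i) F.≈ F.0# × ¬ proj₂ (elt i) K.≈ K.0#

  onAxis₁? : ∀ i → Dec (OnAxis₁ i)
  onAxis₁? i = ¬? (proj₁ (elt i) F.≈? F.0#) ×-dec (proj₂ (elt i) K.≈? K.0#)

  onAxis₂? : ∀ i → Dec (OnAxis₂ i)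
  onAxis₂? i = (proj₁ (elt i) F.≈? F.0#) ×-dec ¬? (proj₂ (elt i) K.≈? K.0#)

  axis₁ axis₂ : Subset size
  axis₁ = tabulate (λ i → does (onAxis₁? i))
  axis₂ = tabulate (λ i → does (onAxis₂? i))

  IsVertex⇒OnAxis : ∀ {i} → IsVertex i → OnAxis₁ i ⊎ OnAxis₂ i
  IsVertex⇒OnAxis {i} (i≉0 , (u , w) , uw≉0 , (xu≈0 , yw≈0)) with proj₁ (elt i) F.≈? F.0#
  ... | yes x≈0 = inj₂ (x≈0 , λ y≈0 → i≉0 (x≈0 , y≈0))
  ... | no  x≉0 = inj₁ (x≉0 , K′.x*y≈0⇒x≈0 w≉0 yw≈0)
    where
    w≉0 : ¬ w K.≈ K.0#
    w≉0 w≈0 = uw≉0 (F′.x*y≈0⇒y≈0 x≉0 xu≈0 , w≈0)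

  OnAxis₁⇒IsVertex : ∀ {i} → OnAxis₁ i → IsVertex i
  OnAxis₁⇒IsVertex (x≉0 , y≈0) =
    (λ i≈0 → x≉0 (proj₁ i≈0)) , (F.0# , K.1#) , (λ e → K′.1≉0 (proj₂ e)) ,
    (F.zeroʳ _ , K.trans (K.*-identityʳ _) y≈0)

  OnAxis₂⇒IsVertex : ∀ {i} → OnAxis₂ i → IsVertex i
  OnAxis₂⇒IsVertex (x≈0 , y≉0) =
    (λ i≈0 → y≉0 (proj₂ i≈0)) , (F.1# , K.0#) , (λ e → F′.1≉0 (proj₁ e)) ,
    (F.trans (F.*-identityʳ _) x≈0 , K.zeroʳ _)

  OnAxis₁×OnAxis₂⇒Adj : ∀ {i j} → OnAxis₁ i → OnAxis₂ j → Adj i j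
  OnAxis₁×OnAxis₂⇒Adj i₁@(x≉0 , y≈0) j₂@(x′≈0 , y′≉0) =
    OnAxis₁⇒IsVertex i₁ , OnAxis₂⇒IsVertex j₂ , (λ { refl → x≉0 x′≈0 }) ,
    (F.trans (F.*-congˡ x′≈0) (F.zeroʳ _) , K.trans (K.*-congʳ y≈0) (K.zeroˡ _))

  OnAxis₁⇒¬Adj : ∀ {i j} → OnAxis₁ i → OnAxis₁ j → ¬ Adj i j
  OnAxis₁⇒¬Adj (x≉0 , _) (x′≉0 , _) (_ , _ , _ , (xx′≈0 , _)) = x′≉0 (F′.x*y≈0⇒y≈0 x≉0 xx′≈0)

  OnAxis₂⇒¬Adj : ∀ {i j} → OnAxis₂ i → OnAxis₂ j → ¬ Adj i j
  OnAxis₂⇒¬Adj (_ , y≉0) (_ , y′≉0) (_ , _ , _ , (_ , yy′≈0)) = y′≉0 (K′.x*y≈0⇒y≈0 y≉0 yy′≈0)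

  N[axis₁]≡axis₂ : ∀ {v} → v ∈ axis₁ → N v ≡ axis₂
  N[axis₁]≡axis₂ v∈ =
    N≡ neighbour (λ j∈ → OnAxis₁×OnAxis₂⇒Adj v₁ (∈-tabulate-does⁻ onAxis₂? j∈))
    where
    v₁ : OnAxis₁ _
    v₁ = ∈-tabulate-does⁻ onAxis₁? v∈
    neighbour : ∀ {j} → Adj _ j → j ∈ axis₂
    neighbour adj with IsVertex⇒OnAxis (proj₁ (proj₂ adj))
    ... | inj₁ j₁ = contradiction adj (OnAxis₁⇒¬Adj v₁ j₁)
    ... | inj₂ j₂ = ∈-tabulate-does⁺ onAxis₂? j₂

  N[axis₂]≡axis₁ : ∀ {v} → v ∈ axis₂ → N v ≡ axis₁
  N[axis₂]≡axis₁ v∈ =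
    N≡ neighbour (λ j∈ → Adj-sym (OnAxis₁×OnAxis₂⇒Adj (∈-tabulate-does⁻ onAxis₁? j∈) v₂))
    where
    v₂ : OnAxis₂ _
    v₂ = ∈-tabulate-does⁻ onAxis₂? v∈
    neighbour : ∀ {j} → Adj _ j → j ∈ axis₁
    neighbour adj with IsVertex⇒OnAxis (proj₁ (proj₂ adj))
    ... | inj₁ j₁ = ∈-tabulate-does⁺ onAxis₁? j₁
    ... | inj₂ j₂ = contradiction adj (OnAxis₂⇒¬Adj v₂ j₂)

  isCompleteBipartite : IsCompleteBipartite axis₁ axis₂
  isCompleteBipartite = record
    { A⊆V = λ i∈ → ∈V⁺ (OnAxis₁⇒IsVertex (∈-tabulate-does⁻ onAxis₁? i∈))
    ; B⊆V = λ i∈ → ∈V⁺ (OnAxis₂⇒IsVertex (∈-tabulate-does⁻ onAxis₂? i∈))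
    ; V⊆A∪B = λ i∈ → Sum.map (∈-tabulate-does⁺ onAxis₁?) (∈-tabulate-does⁺ onAxis₂?)
                              (IsVertex⇒OnAxis (∈V⁻ i∈))
    ; N[A]≡B = N[axis₁]≡axis₂
    ; N[B]≡A = N[axis₂]≡axis₁
    }

  axis₁-nonempty : Nonempty axis₁
  axis₁-nonempty = E.to (F.1# , K.0#) , ∈-tabulate-does⁺ onAxis₁? (x≉0 , y≈0)
    where
    x≈1 : proj₁ (elt (E.to (F.1# , K.0#))) F.≈ F.1#
    x≈1 = proj₁ (E.inverseʳ refl)
    y≈0 : proj₂ (elt (E.to (F.1# , K.0#))) K.≈ K.0#
    y≈0 = proj₂ (E.inverseʳ refl)
    x≉0 : ¬ proj₁ (elt (E.to (F.1# , K.0#))) F.≈ F.0#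
    x≉0 x≈0 = F′.1≉0 (F.trans (F.sym x≈1) x≈0)

  axis₂-nonempty : Nonempty axis₂
  axis₂-nonempty = E.to (F.0# , K.1#) , ∈-tabulate-does⁺ onAxis₂? (x≈0 , y≉0)
    where
    x≈0 : proj₁ (elt (E.to (F.0# , K.1#))) F.≈ F.0#
    x≈0 = proj₁ (E.inverseʳ refl)
    y≈1 : proj₂ (elt (E.to (F.0# , K.1#))) K.≈ K.1#
    y≈1 = proj₂ (E.inverseʳ refl)
    y≉0 : ¬ proj₂ (elt (E.to (F.0# , K.1#))) K.≈ K.0#
    y≉0 y≈0 = K′.1≉0 (K.trans (K.sym y≈1) y≈0)

  -- elt enumerates F × K through remQuot, so the first step is definitional unfolding.
  ∣axis₁∣≡∣F∣∸1 : ∣ axis₁ ∣ ≡ F.size ∸ 1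
  ∣axis₁∣≡∣F∣∸1 = begin
    ∣ axis₁ ∣
      ≡⟨ ∣tabulate-∧-remQuot∣ (λ x → does (¬? (F.elt x F.≈? F.0#))) (λ y → does (K.elt y K.≈? K.0#)) ⟩
    ∣ Zeros.nonzeros F.finRing ∣ *ℕ ∣ Zeros.zeros K.finRing ∣
      ≡⟨ cong₂ _*ℕ_ (Zeros.∣nonzeros∣≡size∸1 F.finRing) (Zeros.∣zeros∣≡1 K.finRing) ⟩
    (F.size ∸ 1) *ℕ 1                                  ≡⟨ *-identityʳ _ ⟩
    F.size ∸ 1                                         ∎
    where open ≡-Reasoning

  ∣axis₂∣≡∣K∣∸1 : ∣ axis₂ ∣ ≡ K.size ∸ 1
  ∣axis₂∣≡∣K∣∸1 = begin
    ∣ axis₂ ∣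
      ≡⟨ ∣tabulate-∧-remQuot∣ (λ x → does (F.elt x F.≈? F.0#)) (λ y → does (¬? (K.elt y K.≈? K.0#))) ⟩
    ∣ Zeros.zeros F.finRing ∣ *ℕ ∣ Zeros.nonzeros K.finRing ∣
      ≡⟨ cong₂ _*ℕ_ (Zeros.∣zeros∣≡1 F.finRing) (Zeros.∣nonzeros∣≡size∸1 K.finRing) ⟩
    1 *ℕ (K.size ∸ 1)                                  ≡⟨ *-identityˡ _ ⟩
    K.size ∸ 1                                         ∎
    where open ≡-Reasoning

lemma2p3 : ∀ {c₁ ℓ₁ c₂ ℓ₂} (F : FiniteField c₁ ℓ₁) (K : FiniteField c₂ ℓ₂) →
    FiniteCommRing.OffensiveAllianceNumber≡
      (FiniteField.finRing F ×FR FiniteField.finRing K)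
      ((FiniteField.size F ∸ 1) ⊓ (FiniteField.size K ∸ 1))
lemma2p3 F K =
  subst (FiniteCommRing.OffensiveAllianceNumber≡ (FiniteField.finRing F ×FR FiniteField.finRing K))
        (cong₂ _⊓_ ∣axis₁∣≡∣F∣∸1 ∣axis₂∣≡∣K∣∸1)
        (offensiveAllianceNumber≡∣A∣⊓∣B∣ isCompleteBipartite axis₁-nonempty axis₂-nonempty)
  where
  open FieldProduct F K
  open ZeroDivisorGraph (FiniteField.finRing F ×FR FiniteField.finRing K)
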